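{- Let $\sigma\in\mathbb{Z}_{>0}$, $T\in[0..\sigma)^n$ with $n\ge2$, and let $G$ be a 1D SLP representing $T$. There exists a 2D SLG $G'$ of size $|G'|=\mathcal{O}(|G|+\sigma)$ that represents $\mathrm{ExtMarkAllChars}(T,\sigma)$.
   Context: $\mathrm{ExtMarkAllChars}(T,\sigma)\in\{0,1\}^{n\sigma\times n}$ is the matrix obtained by stacking, top to bottom for $a=0,1,\dots,\sigma-1$, the $n\times n$ blocks $B_a$, where the first row of $B_a$ has entry $1$ in column $j$ iff $T[j]=a$ (and $0$ otherwise), and the remaining $n-1$ rows of $B_a$ are all zero. 1D SLP: $G=(V,\Sigma,R,S)$, each $N\in V$ has exactly one rule $N\to\mathrm{rhs}(N)$ with $\mathrm{rhs}(N)\in\Sigma$ or $\mathrm{rhs}(N)=AB$ ($A,B\in V$), with an ordering $N_1,\dots,N_{|V|}$ such that $\mathrm{rhs}(N_i)$ only uses $N_j$, $j>i$; it represents the string derived from $S$; $|G|=\sum_{N\in V}\max(|\mathrm{rhs}(N)|,1)$. 2D SLG: $G'=(V_l,V_h,V_v,\Sigma',R',S')$ with $V_l$ (nonempty), $V_h,V_v,\Sigma'$ pairwise disjoint finite sets, $V=V_l\cup V_h\cup V_v$, $S'\in V$; each $N\in V_l$ has $\mathrm{rhs}(N)\in\Sigma'$, each $N\in V_h\cup V_v$ has $\mathrm{rhs}(N)$ a string over $V$, with an ordering $N_1,\dots,N_{|V|}$ such that $\mathrm{rhs}(N_i)$ only uses $N_j$, $j>i$. Expansions: $N\in V_l$ gives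 the $1\times1$ matrix $\mathrm{rhs}(N)$; for $N\in V_h$ the expansions of the symbols of $\mathrm{rhs}(N)$ (equal numbers of columns required) are stacked top to bottom in order; for $N\in V_v$ they (equal numbers of rows required) are placed left to right in order. $G'$ represents $\mathrm{exp}(S')$; $|G'|=\sum_{N\in V}\max(|\mathrm{rhs}(N)|,1)$. -}

module Defs where

open import Data.Nat using (ℕ; zero; suc; _+_; _*_; _<_; _⊔_)
open import Data.Fin using (Fin; zero; suc; toℕ; _≟_)
open import Data.Bool using (if_then_else_)
open import Data.List as List using (List; []; _∷_; length)
open import Data.List.Relation.Unary.All using (All)
open import Data.Vec as Vec using (Vec)
open import Data.Nat.ListAction using (sum)
open import Data.Product using (Σ; Σ-syntax)
open import Relation.Binary.PropositionalEquality using (_≡_)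
open import Relation.Nullary.Decidable using (⌊_⌋)

-- Nonterminals are Fin m, listed in the required order N_1,…,N_m
-- (index i = N_{i+1}); a rule of N_i may only use N_j with j > i.
-- Terminals are natural numbers (the alphabet Σ is the finite set of
-- terminals occurring in the rules).

data Rhs1 (m : ℕ) : Set where
  term : ℕ → Rhs1 m
  bin  : Fin m → Fin m → Rhs1 m

OrderedRhs1 : ∀ {m} → Fin m → Rhs1 m → Set
OrderedRhs1 i (term a)  = Data.Unit.Polymorphic.⊤ where import Data.Unit.Polymorphic
OrderedRhs1 i (bin A B) = (toℕ i < toℕ A) Data.Product.× (toℕ i < toℕ B)

record SLP : Set where
  field
    m       : ℕ
    rule    : Fin m → Rhs1 m
    ordered : (i : Fin m) → OrderedRhs1 i (rule i)
    start   : Fin m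

data Exp1 (G : SLP) : Fin (SLP.m G) → List ℕ → Set where
  leaf : ∀ {N a} → SLP.rule G N ≡ term a → Exp1 G N (a ∷ [])
  node : ∀ {N A B u v} → SLP.rule G N ≡ bin A B →
         Exp1 G A u → Exp1 G B v → Exp1 G N (u List.++ v)

Represents1 : SLP → List ℕ → Set
Represents1 G w = Exp1 G (SLP.start G) w

rhsSize1 : ∀ {m} → Rhs1 m → ℕ
rhsSize1 (term _)  = 1
rhsSize1 (bin _ _) = 2

size1 : SLP → ℕ
size1 G = sum (List.tabulate (λ i → rhsSize1 (SLP.rule G i)))

-- 2D straight-line grammars.
-- The partition V = V_l ∪ V_h ∪ V_v is encoded by the constructor of
-- each nonterminal's rule (so the three sets are automatically disjoint).

data Rhs2 (m : ℕ) : Set where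
  leaf2 : ℕ → Rhs2 m
  hor   : List (Fin m) → Rhs2 m      -- N ∈ V_h,  children stacked top to bottom
  ver   : List (Fin m) → Rhs2 m      -- N ∈ V_v,  children placed left to right

OrderedRhs2 : ∀ {m} → Fin m → Rhs2 m → Set
OrderedRhs2 i (leaf2 a) = Data.Unit.Polymorphic.⊤ where import Data.Unit.Polymorphic
OrderedRhs2 i (hor xs)  = All (λ j → toℕ i < toℕ j) xs
OrderedRhs2 i (ver xs)  = All (λ j → toℕ i < toℕ j) xs

IsLeaf : ∀ {m} → Rhs2 m → Set
IsLeaf (leaf2 _) = Data.Unit.Polymorphic.⊤ where import Data.Unit.Polymorphic
IsLeaf (hor _)   = Data.Empty.Polymorphic.⊥ where import Data.Empty.Polymorphic
IsLeaf (ver _)   = Data.Empty.Polymorphic.⊥ where import Data.Empty.Polymorphic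

record SLG : Set where
  field
    m        : ℕ
    rule     : Fin m → Rhs2 m
    ordered  : (i : Fin m) → OrderedRhs2 i (rule i)
    leafNE   : Σ[ i ∈ Fin m ] IsLeaf (rule i)
    start    : Fin m

Mat : ℕ → ℕ → Set
Mat r c = Vec (Vec ℕ c) r

mutual
  data Exp2 (G : SLG) : Fin (SLG.m G) → (r c : ℕ) → Mat r c → Set where
    leafE : ∀ {N a} → SLG.rule G N ≡ leaf2 a →
            Exp2 G N 1 1 ((a Vec.∷ Vec.[]) Vec.∷ Vec.[])
    horE  : ∀ {N xs r c M} → SLG.rule G N ≡ hor xs → Stack G xs r c M → Exp2 G N r c M
    verE  : ∀ {N xs r c M} → SLG.rule G N ≡ ver xs → Side G xs r c M → Exp2 G N r c M

  data Stack (G : SLG) : List (Fin (SLG.m G)) → (r c : ℕ) → Mat r c → Set where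
    one  : ∀ {A r c M} → Exp2 G A r c M → Stack G (A ∷ []) r c M
    more : ∀ {A As r₁ r₂ c M₁ M₂} → Exp2 G A r₁ c M₁ → Stack G As r₂ c M₂ →
           Stack G (A ∷ As) (r₁ + r₂) c (M₁ Vec.++ M₂)

  data Side (G : SLG) : List (Fin (SLG.m G)) → (r c : ℕ) → Mat r c → Set where
    one  : ∀ {A r c M} → Exp2 G A r c M → Side G (A ∷ []) r c M
    more : ∀ {A As r c₁ c₂ M₁ M₂} → Exp2 G A r c₁ M₁ → Side G As r c₂ M₂ →
           Side G (A ∷ As) r (c₁ + c₂) (Vec.zipWith Vec._++_ M₁ M₂)

Represents2 : (G : SLG) → {r c : ℕ} → Mat r c → Set
Represents2 G {r} {c} M = Exp2 G (SLG.start G) r c M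

rhsSize2 : ∀ {m} → Rhs2 m → ℕ
rhsSize2 (leaf2 _) = 1
rhsSize2 (hor xs)  = length xs ⊔ 1
rhsSize2 (ver xs)  = length xs ⊔ 1

size2 : SLG → ℕ
size2 G = sum (List.tabulate (λ i → rhsSize2 (SLG.rule G i)))

markRow : ∀ {σ n} → Vec (Fin σ) n → Fin σ → Vec ℕ n
markRow T a = Vec.map (λ t → if ⌊ t ≟ a ⌋ then 1 else 0) T

block : ∀ {σ n} → Vec (Fin σ) n → Fin σ → Mat n n
block {n = n} T a = Vec.tabulate row
  where
    row : Fin n → Vec ℕ n
    row zero    = markRow T a
    row (suc _) = Vec.replicate n 0

ExtMarkAllChars : ∀ {σ n} → Vec (Fin σ) n → Mat (σ * n) n
ExtMarkAllChars {σ} T = Vec.concat (Vec.tabulate {n = σ} (block T))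

toString : ∀ {σ n} → Vec (Fin σ) n → List ℕ
toString T = Vec.toList (Vec.map toℕ T)

-- Column j of ExtMarkAllChars(T, σ) is the unit vector of height σn with its 1 in row T[j]·n.
-- Copying every rule N → A B of G as the left-to-right placement of the copies of A and B
-- leaves only the σ possible columns to be produced, and these share their zero parts.  Three
-- more copies of G give the zero column Z_N and the column E_N = (1, 0, …, 0) of height
-- |exp(N)|, and a chain W_p → Z_S W_{p+1} gives the zero column of height (σ − p)n.  The column
-- of a character b is W_{σ−b} E_S W_{b+1} (dropping empty parts), so there are 3|V| + σ
-- nonterminals, each with a right-hand side of length at most 3.
--
-- For correctness, row i of ExtMarkAllChars(T, σ) is T mapped pointwise by a fixed function
-- hᵢ : ℕ → ℕ; hence the rows of the matrix of a concatenation u v are the concatenations of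
-- the rows for u and for v, which is what placing the copies of A and B side by side produces.
module Submission where

open import Defs
open import Data.Nat using (ℕ; _+_; _*_; _≤_; _<_)
open import Data.Fin using (Fin)
open import Data.Vec using (Vec)
open import Data.Product using (Σ-syntax; _×_)

open import Data.Bool using (if_then_else_)
open import Data.Fin as F using (toℕ; fromℕ<)
import Data.Fin.Properties as FP
open import Data.List as L using (List; []; _∷_; [_]; _++_; length)
import Data.List.Properties as LP
open import Data.List.Relation.Unary.All as All using (All; []; _∷_)
import Data.List.Relation.Unary.All.Properties as AllP
open import Data.Nat using (zero; suc; _∸_; z≤n; s≤s; s≤s⁻¹; _≟_)
open import Data.Nat.ListAction using (sum)
open import Data.Nat.Properties
open import Data.Nat.Tactic.RingSolver using (solve-∀)
open import Data.Product using (_,_; proj₁; proj₂)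
open import Data.Sum using (inj₁; inj₂; _⊎_)
open import Data.Sum.Function.Propositional using (_⊎-↔_)
open import Data.Unit.Polymorphic using (tt)
import Data.Vec as V
import Data.Vec.Properties as VP
open import Function using (_∘_; const; _↔_; Inverse)
open import Function.Properties.Inverse using (↔-trans; ↔-refl)
open import Relation.Binary.PropositionalEquality hiding ([_])
open import Relation.Nullary using (yes; no; contradiction)
open import Relation.Nullary.Decidable using (⌊_⌋)

replicate-+ : ∀ {A : Set} m n (x : A) → L.replicate (m + n) x ≡ L.replicate m x ++ L.replicate n x
replicate-+ zero    n x = refl
replicate-+ (suc m) n x = cong (x ∷_) (replicate-+ m n x)

applyUpTo-+ : ∀ {A : Set} (f : ℕ → A) m n →
              L.applyUpTo f (m + n) ≡ L.applyUpTo f m ++ L.applyUpTo (f ∘ (m +_)) n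
applyUpTo-+ f zero    n = refl
applyUpTo-+ f (suc m) n = cong (f 0 ∷_) (applyUpTo-+ (f ∘ suc) m n)

tabulate-toℕ : ∀ {A : Set} n (f : ℕ → A) → L.tabulate (f ∘ toℕ {n}) ≡ L.applyUpTo f n
tabulate-toℕ zero    f = refl
tabulate-toℕ (suc n) f = cong (f 0 ∷_) (tabulate-toℕ n (f ∘ suc))

sum-tabulate-mono : ∀ {n} {f g : Fin n → ℕ} → (∀ i → f i ≤ g i) →
                    sum (L.tabulate f) ≤ sum (L.tabulate g)
sum-tabulate-mono {zero}  f≤g = z≤n
sum-tabulate-mono {suc n} f≤g = +-mono-≤ (f≤g F.zero) (sum-tabulate-mono (f≤g ∘ F.suc))

sum-tabulate-const : ∀ n c → sum (L.tabulate {n = n} (const c)) ≡ n * c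
sum-tabulate-const zero    c = refl
sum-tabulate-const (suc n) c = cong (c +_) (sum-tabulate-const n c)

toList-injective : ∀ {A : Set} {n} {xs ys : Vec A n} → V.toList xs ≡ V.toList ys → xs ≡ ys
toList-injective {xs = xs} {ys} eq =
  trans (sym (VP.cast-is-id refl xs)) (VP.toList-injective refl xs ys eq)

rows : ∀ {r c} → Mat r c → List (List ℕ)
rows M = L.map V.toList (V.toList M)

length-rows : ∀ {r c} (M : Mat r c) → length (rows M) ≡ r
length-rows M = trans (LP.length-map V.toList (V.toList M)) (VP.length-toList M)

rows-injective : ∀ {r c} {M M′ : Mat r c} → rows M ≡ rows M′ → M ≡ M′
rows-injective eq = toList-injective (LP.map-injective toList-injective eq)

rows-++ : ∀ {r₁ r₂ c} (M₁ : Mat r₁ c) (M₂ : Mat r₂ c) → rows (M₁ V.++ M₂) ≡ rows M₁ ++ rows M₂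
rows-++ M₁ M₂ =
  trans (cong (L.map V.toList) (VP.toList-++ M₁ M₂)) (LP.map-++ V.toList (V.toList M₁) _)

rows-zipWith-++ : ∀ {r c₁ c₂} (M₁ : Mat r c₁) (M₂ : Mat r c₂) →
                  rows (V.zipWith V._++_ M₁ M₂) ≡ L.zipWith _++_ (rows M₁) (rows M₂)
rows-zipWith-++ V.[]       V.[]       = refl
rows-zipWith-++ (x V.∷ M₁) (y V.∷ M₂) = cong₂ _∷_ (VP.toList-++ x y) (rows-zipWith-++ M₁ M₂)

rows-concat-tabulate : ∀ {k r c} (f : Fin k → Mat r c) →
                       rows (V.concat (V.tabulate f)) ≡ L.concat (L.tabulate (rows ∘ f))
rows-concat-tabulate {zero}  f = refl
rows-concat-tabulate {suc k} f =
  trans (rows-++ (f F.zero) _) (cong (rows (f F.zero) ++_) (rows-concat-tabulate (f ∘ F.suc)))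

rows-tabulate-const : ∀ j {c} (v : Vec ℕ c) →
                      rows (V.tabulate {n = j} (const v)) ≡ L.replicate j (V.toList v)
rows-tabulate-const zero    v = refl
rows-tabulate-const (suc j) v = cong (V.toList v ∷_) (rows-tabulate-const j v)

pointwise : List (ℕ → ℕ) → List ℕ → List (List ℕ)
pointwise hs w = L.map (λ h → L.map h w) hs

pointwise-++ : ∀ hs hs′ w → pointwise (hs ++ hs′) w ≡ pointwise hs w ++ pointwise hs′ w
pointwise-++ hs hs′ w = LP.map-++ (λ h → L.map h w) hs hs′

zipWith-++-pointwise : ∀ hs u v →
                       L.zipWith _++_ (pointwise hs u) (pointwise hs v) ≡ pointwise hs (u ++ v)
zipWith-++-pointwise []       u v = refl
zipWith-++-pointwise (h ∷ hs) u v =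
  cong₂ _∷_ (sym (LP.map-++ h u v)) (zipWith-++-pointwise hs u v)

length-toString : ∀ {σ n} (T : Vec (Fin σ) n) → length (toString T) ≡ n
length-toString T = VP.length-toList (V.map toℕ T)

toString-< : ∀ {σ n} (T : Vec (Fin σ) n) → All (_< σ) (toString T)
toString-< T = subst (All _) (sym (VP.toList-map toℕ T))
                     (AllP.map⁺ (All.universal FP.toℕ<n (V.toList T)))

module _ {G : SLP} where

  1≤length-exp : ∀ {N w} → Exp1 G N w → 1 ≤ length w
  1≤length-exp (leaf _)                 = s≤s z≤n
  1≤length-exp (node {u = u} {v} _ dA _) =
    subst (1 ≤_) (sym (LP.length-++ u)) (≤-trans (1≤length-exp dA) (m≤m+n _ _))

  terminal-rule : ∀ {N w} → Exp1 G N w → Σ[ N′ ∈ Fin (SLP.m G) ] Σ[ a ∈ ℕ ] SLP.rule G N′ ≡ term a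
  terminal-rule (leaf N→a)    = _ , _ , N→a
  terminal-rule (node _ dA _) = terminal-rule dA

count≤size1 : ∀ G → SLP.m G ≤ size1 G
count≤size1 G = begin
  SLP.m G                                   ≡⟨ sym (*-identityʳ _) ⟩
  SLP.m G * 1                               ≡⟨ sym (sum-tabulate-const (SLP.m G) 1) ⟩
  sum (L.tabulate {n = SLP.m G} (const 1))  ≤⟨ sum-tabulate-mono (1≤rhsSize1 ∘ SLP.rule G) ⟩
  size1 G                                   ∎
  where
  open ≤-Reasoning
  1≤rhsSize1 : ∀ {m} (r : Rhs1 m) → 1 ≤ rhsSize1 r
  1≤rhsSize1 (term _)  = s≤s z≤n
  1≤rhsSize1 (bin _ _) = s≤s z≤n

module Derivations (G : SLG) where
  open SLG G using (rule)

  -- The row count is left existential and matrices are compared through their rows, so the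
  -- index arithmetic of Stack and Side never has to hold definitionally.
  Yields : Fin (SLG.m G) → ℕ → List (List ℕ) → Set
  Yields x c L = Σ[ r ∈ ℕ ] Σ[ M ∈ Mat r c ] (Exp2 G x r c M × rows M ≡ L)

  data Stacked (c : ℕ) : List (Fin (SLG.m G)) → List (List ℕ) → Set where
    []  : Stacked c [] []
    _∷_ : ∀ {x xs L Ls} → Yields x c L → Stacked c xs Ls → Stacked c (x ∷ xs) (L ++ Ls)

  [_]ˢ : ∀ {c x L} → Yields x c L → Stacked c (x ∷ []) L
  [ d ]ˢ = subst (Stacked _ _) (LP.++-identityʳ _) (d ∷ [])

  _++ˢ_ : ∀ {c xs ys L L′} → Stacked c xs L → Stacked c ys L′ → Stacked c (xs ++ ys) (L ++ L′)
  []                     ++ˢ t = t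
  (_∷_ {L = L} {Ls} d s) ++ˢ t = subst (Stacked _ _) (sym (LP.++-assoc L Ls _)) (d ∷ (s ++ˢ t))

  stack : ∀ {c x xs L} → Stacked c (x ∷ xs) L →
          Σ[ r ∈ ℕ ] Σ[ M ∈ Mat r c ] (Stack G (x ∷ xs) r c M × rows M ≡ L)
  stack ((_ , M , d , refl) ∷ [])      = _ , M , one d , sym (LP.++-identityʳ (rows M))
  stack ((_ , M , d , refl) ∷ (e ∷ s)) with stack (e ∷ s)
  ... | _ , M′ , st , p = _ , M V.++ M′ , more d st , trans (rows-++ M M′) (cong (rows M ++_) p)

  yields-leaf : ∀ {x a} → rule x ≡ leaf2 a → Yields x 1 [ [ a ] ]
  yields-leaf x→a = 1 , _ , leafE x→a , refl

  yields-hor : ∀ {x xs c L} → rule x ≡ hor xs → xs ≢ [] → Stacked c xs L → Yields x c L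
  yields-hor {xs = []}    _   xs≢[] _ = contradiction refl xs≢[]
  yields-hor {xs = _ ∷ _} x→xs _    s with stack s
  ... | r , M , st , p = r , M , horE x→xs st , p

  yields-ver : ∀ {x y z c₁ c₂ L₁ L₂} → rule x ≡ ver (y ∷ z ∷ []) →
               Yields y c₁ L₁ → Yields z c₂ L₂ → length L₁ ≡ length L₂ →
               Yields x (c₁ + c₂) (L.zipWith _++_ L₁ L₂)
  yields-ver x→yz (r₁ , M₁ , d₁ , refl) (r₂ , M₂ , d₂ , refl) same-length
    with trans (sym (length-rows M₁)) (trans same-length (length-rows M₂))
  ... | refl = r₁ , V.zipWith V._++_ M₁ M₂ , verE x→yz (more d₁ (one d₂)) , rows-zipWith-++ M₁ M₂

  yields⇒exp2 : ∀ {x r c} {M : Mat r c} → Yields x c (rows M) → Exp2 G x r c M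
  yields⇒exp2 {M = M} (_ , M′ , d , eq)
    with trans (sym (length-rows M′)) (trans (cong length eq) (length-rows M))
  ... | refl = subst (Exp2 G _ _ _) (rows-injective eq) d

indicator : ℕ → ℕ → ℕ
indicator a x = if ⌊ x ≟ a ⌋ then 1 else 0

indicator-refl : ∀ a → indicator a a ≡ 1
indicator-refl a with a ≟ a
... | yes _   = refl
... | no a≢a = contradiction refl a≢a

indicator-≢ : ∀ {a x} → x ≢ a → indicator a x ≡ 0
indicator-≢ {a} {x} x≢a with x ≟ a
... | yes x≡a = contradiction x≡a x≢a
... | no _    = refl

indicator-toℕ : ∀ {σ} (t a : Fin σ) → indicator (toℕ a) (toℕ t) ≡ (if ⌊ t F.≟ a ⌋ then 1 else 0)
indicator-toℕ t a with t F.≟ a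
... | yes refl = indicator-refl (toℕ t)
... | no t≢a   = indicator-≢ (t≢a ∘ FP.toℕ-injective)

zeros : ℕ → List (List ℕ)
zeros h = L.replicate h [ 0 ]

zeros-+ : ∀ h h′ → zeros h ++ zeros h′ ≡ zeros (h + h′)
zeros-+ h h′ = sym (replicate-+ h h′ [ 0 ])

module Markers (k : ℕ) where

  markerBlock : ℕ → List (ℕ → ℕ)
  markerBlock a = indicator a ∷ L.replicate k (const 0)

  markers : ℕ → List (ℕ → ℕ)
  markers σ = L.concat (L.applyUpTo markerBlock σ)

  markerBlock-column : ∀ a b → pointwise (markerBlock a) [ b ] ≡ [ indicator a b ] ∷ zeros k
  markerBlock-column a b = cong ([ indicator a b ] ∷_) (LP.map-replicate _ k (const 0))

  column-avoiding : ∀ b (f : ℕ → ℕ) j → (∀ i → i < j → b ≢ f i) →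
                    pointwise (L.concat (L.applyUpTo (markerBlock ∘ f) j)) [ b ] ≡ zeros (j * suc k)
  column-avoiding b f zero    _     = refl
  column-avoiding b f (suc j) avoid = begin
    col (markerBlock (f 0) ++ L.concat rest)           ≡⟨ pointwise-++ (markerBlock (f 0)) _ [ b ] ⟩
    col (markerBlock (f 0)) ++ col (L.concat rest)     ≡⟨ cong₂ _++_ head-column tail-column ⟩
    zeros (suc k) ++ zeros (j * suc k)                 ≡⟨ zeros-+ (suc k) (j * suc k) ⟩
    zeros (suc j * suc k)                              ∎
    where
    open ≡-Reasoning
    col : List (ℕ → ℕ) → List (List ℕ)
    col hs = pointwise hs [ b ]
    rest = L.applyUpTo (markerBlock ∘ f ∘ suc) j
    head-column : col (markerBlock (f 0)) ≡ zeros (suc k)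
    head-column = trans (markerBlock-column (f 0) b)
                        (cong (λ x → [ x ] ∷ zeros k) (indicator-≢ (avoid 0 (s≤s z≤n))))
    tail-column : col (L.concat rest) ≡ zeros (j * suc k)
    tail-column = column-avoiding b (f ∘ suc) j (λ i i<j → avoid (suc i) (s≤s i<j))

  markers-column : ∀ b q → pointwise (markers (b + suc q)) [ b ] ≡
                           zeros (b * suc k) ++ ([ 1 ] ∷ zeros k) ++ zeros (q * suc k)
  markers-column b q = begin
    col (L.concat (L.applyUpTo markerBlock (b + suc q)))
      ≡⟨ cong (col ∘ L.concat) (applyUpTo-+ markerBlock b (suc q)) ⟩
    col (L.concat (before ++ markerBlock (b + 0) ∷ after))
      ≡⟨ cong col (sym (LP.concat-++ before _)) ⟩
    col (L.concat before ++ markerBlock (b + 0) ++ L.concat after)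
      ≡⟨ pointwise-++ (L.concat before) _ [ b ] ⟩
    col (L.concat before) ++ col (markerBlock (b + 0) ++ L.concat after)
      ≡⟨ cong (col (L.concat before) ++_) (pointwise-++ (markerBlock (b + 0)) _ [ b ]) ⟩
    col (L.concat before) ++ col (markerBlock (b + 0)) ++ col (L.concat after)
      ≡⟨ cong₂ _++_ (column-avoiding b (λ i → i) b (λ i i<b → ≢-sym (<⇒≢ i<b)))
                    (cong₂ _++_ own-column
                                (column-avoiding b (λ i → b + suc i) q (λ i _ → ≢-sym (m+1+n≢m b)))) ⟩
    zeros (b * suc k) ++ ([ 1 ] ∷ zeros k) ++ zeros (q * suc k) ∎
    where
    open ≡-Reasoning
    col : List (ℕ → ℕ) → List (List ℕ)
    col hs = pointwise hs [ b ]
    before = L.applyUpTo markerBlock b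
    after  = L.applyUpTo (λ i → markerBlock (b + suc i)) q
    own-column : col (markerBlock (b + 0)) ≡ [ 1 ] ∷ zeros k
    own-column = trans (markerBlock-column (b + 0) b)
                       (cong (λ x → [ x ] ∷ zeros k)
                             (trans (cong (λ a → indicator a b) (+-identityʳ b)) (indicator-refl b)))

  markRow-toList : ∀ {σ} (T : Vec (Fin σ) (suc k)) a →
                   V.toList (markRow T a) ≡ L.map (indicator (toℕ a)) (toString T)
  markRow-toList T a = begin
    V.toList (markRow T a)
      ≡⟨ VP.toList-map _ T ⟩
    L.map (λ t → if ⌊ t F.≟ a ⌋ then 1 else 0) (V.toList T)
      ≡⟨ LP.map-cong (λ t → sym (indicator-toℕ t a)) (V.toList T) ⟩
    L.map (indicator (toℕ a) ∘ toℕ) (V.toList T)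
      ≡⟨ LP.map-∘ (V.toList T) ⟩
    L.map (indicator (toℕ a)) (L.map toℕ (V.toList T))
      ≡⟨ cong (L.map (indicator (toℕ a))) (sym (VP.toList-map toℕ T)) ⟩
    L.map (indicator (toℕ a)) (toString T) ∎
    where open ≡-Reasoning

  rows-block : ∀ {σ} (T : Vec (Fin σ) (suc k)) a →
               rows (block T a) ≡ pointwise (markerBlock (toℕ a)) (toString T)
  rows-block T a = cong₂ _∷_ (markRow-toList T a) (begin
    rows (V.tabulate {n = k} (const (V.replicate (suc k) 0)))
      ≡⟨ rows-tabulate-const k (V.replicate (suc k) 0) ⟩
    L.replicate k (V.toList (V.replicate (suc k) 0))
      ≡⟨ cong (L.replicate k ∘ V.toList) (sym (VP.map-const (V.map toℕ T) 0)) ⟩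
    L.replicate k (V.toList (V.map (const 0) (V.map toℕ T)))
      ≡⟨ cong (L.replicate k) (VP.toList-map (const 0) (V.map toℕ T)) ⟩
    L.replicate k (L.map (const 0) (toString T))
      ≡⟨ sym (LP.map-replicate (λ h → L.map h (toString T)) k (const 0)) ⟩
    pointwise (L.replicate k (const 0)) (toString T) ∎)
    where open ≡-Reasoning

  rows-ExtMarkAllChars : ∀ {σ} (T : Vec (Fin σ) (suc k)) →
                         rows (ExtMarkAllChars T) ≡ pointwise (markers σ) (toString T)
  rows-ExtMarkAllChars {σ} T = begin
    rows (V.concat (V.tabulate (block T)))
      ≡⟨ rows-concat-tabulate (block T) ⟩
    L.concat (L.tabulate (rows ∘ block T))
      ≡⟨ cong L.concat (LP.tabulate-cong (rows-block T)) ⟩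
    L.concat (L.tabulate (λ a → pointwise (markerBlock (toℕ {σ} a)) w))
      ≡⟨ cong L.concat (sym (LP.map-tabulate (markerBlock ∘ toℕ {σ}) (λ hs → pointwise hs w))) ⟩
    L.concat (L.map (λ hs → pointwise hs w) blocks)
      ≡⟨ LP.concat-map blocks ⟩
    pointwise (L.concat blocks) w
      ≡⟨ cong (λ hss → pointwise (L.concat hss) w) (tabulate-toℕ σ markerBlock) ⟩
    pointwise (markers σ) w ∎
    where
    open ≡-Reasoning
    w = toString T
    blocks = L.tabulate (markerBlock ∘ toℕ {σ})

-- In the notation of the header: marks N is the copy of N, zeroBlocks p = W_p,
-- unitCol N = E_N and zeroCol N = Z_N.
pattern marks N      = inj₁ N
pattern zeroBlocks p = inj₂ (inj₁ p)
pattern unitCol N    = inj₂ (inj₂ (inj₁ N))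
pattern zeroCol N    = inj₂ (inj₂ (inj₂ N))

module MarkGrammar (σ′ : ℕ) (G : SLP)
                   (terminal : Σ[ N ∈ Fin (SLP.m G) ] Σ[ a ∈ ℕ ] SLP.rule G N ≡ term a) where
  open SLP G using (m) renaming (rule to rule₁; ordered to ordered₁; start to S)

  σ : ℕ
  σ = suc σ′

  count : ℕ
  count = m + (σ + (m + m))

  Node : Set
  Node = Fin m ⊎ Fin σ ⊎ Fin m ⊎ Fin m

  layout : Fin count ↔ Node
  layout = ↔-trans FP.+↔⊎ (↔-refl ⊎-↔ ↔-trans FP.+↔⊎ (↔-refl ⊎-↔ FP.+↔⊎))

  open Inverse layout using (to; strictlyInverseˡ; strictlyInverseʳ) renaming (from to index)

  rank : Node → ℕ
  rank (marks N)      = toℕ N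
  rank (zeroBlocks p) = m + toℕ p
  rank (unitCol N)    = m + (σ + toℕ N)
  rank (zeroCol N)    = m + (σ + (m + toℕ N))

  toℕ-index : ∀ y → toℕ (index y) ≡ rank y
  toℕ-index (marks N)      = FP.toℕ-↑ˡ N _
  toℕ-index (zeroBlocks p) = trans (FP.toℕ-↑ʳ m _) (cong (m +_) (FP.toℕ-↑ˡ p _))
  toℕ-index (unitCol N)    =
    trans (FP.toℕ-↑ʳ m _) (cong (m +_) (trans (FP.toℕ-↑ʳ σ _) (cong (σ +_) (FP.toℕ-↑ˡ N _))))
  toℕ-index (zeroCol N)    =
    trans (FP.toℕ-↑ʳ m _) (cong (m +_) (trans (FP.toℕ-↑ʳ σ _) (cong (σ +_) (FP.toℕ-↑ʳ m N))))

  index-< : ∀ y z → rank y < rank z → toℕ (index y) < toℕ (index z)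
  index-< y z = subst₂ _<_ (sym (toℕ-index y)) (sym (toℕ-index z))

  -- zeroBlocks p covers the blocks p, …, σ − 1, so the last h blocks start at σ′ ∸ (h − 1).
  zeroRun : ℕ → List (Fin count)
  zeroRun zero    = []
  zeroRun (suc h) = index (zeroBlocks (fromℕ< (s≤s (m∸n≤m σ′ h)))) ∷ []

  -- Only meaningful for b < σ; larger terminals do not occur in T.
  markColumn : ℕ → List (Fin count)
  markColumn b = zeroRun b ++ index (unitCol S) ∷ zeroRun (σ′ ∸ b)

  marksRhs unitColRhs zeroColRhs : Rhs1 m → Rhs2 count
  marksRhs (term b)    = hor (markColumn b)
  marksRhs (bin A B)   = ver (index (marks A) ∷ index (marks B) ∷ [])
  unitColRhs (term _)  = leaf2 1
  unitColRhs (bin A B) = hor (index (unitCol A) ∷ index (zeroCol B) ∷ [])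
  zeroColRhs (term _)  = leaf2 0
  zeroColRhs (bin A B) = hor (index (zeroCol A) ∷ index (zeroCol B) ∷ [])

  rhs : Node → Rhs2 count
  rhs (marks N)      = marksRhs (rule₁ N)
  rhs (zeroBlocks p) = hor (index (zeroCol S) ∷ zeroRun (σ′ ∸ toℕ p))
  rhs (unitCol N)    = unitColRhs (rule₁ N)
  rhs (zeroCol N)    = zeroColRhs (rule₁ N)

  rule : Fin count → Rhs2 count
  rule = rhs ∘ to

  rule-index : ∀ y → rule (index y) ≡ rhs y
  rule-index y = cong rhs (strictlyInverseˡ y)

  zeroRun-above : ∀ h → All (λ x → m + (σ ∸ h) ≤ toℕ x) (zeroRun h)
  zeroRun-above zero    = []
  zeroRun-above (suc h) =
    ≤-reflexive (sym (trans (toℕ-index (zeroBlocks _))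
                            (cong (m +_) (FP.toℕ-fromℕ< (s≤s (m∸n≤m σ′ h)))))) ∷ []

  marks-ordered : ∀ N r → OrderedRhs1 N r → OrderedRhs2 (index (marks N)) (marksRhs r)
  marks-ordered N (term b)  _           =
    AllP.++⁺ (All.map below (zeroRun-above b))
             (index-< (marks N) (unitCol S) (<-≤-trans (FP.toℕ<n N) (m≤m+n m _)) ∷
              All.map below (zeroRun-above (σ′ ∸ b)))
    where
    below : ∀ {h} {x : Fin count} → m + h ≤ toℕ x → toℕ (index (marks N)) < toℕ x
    below {x = x} m+h≤x = subst (_< toℕ x) (sym (toℕ-index (marks N)))
                                (<-≤-trans (FP.toℕ<n N) (≤-trans (m≤m+n m _) m+h≤x))
  marks-ordered N (bin A B) (N<A , N<B) =
    index-< (marks N) (marks A) N<A ∷ index-< (marks N) (marks B) N<B ∷ []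

  zeroBlocks-ordered : ∀ p → OrderedRhs2 (index (zeroBlocks p)) (rhs (zeroBlocks p))
  zeroBlocks-ordered p =
    index-< (zeroBlocks p) (zeroCol S) (+-monoʳ-< m (<-≤-trans (FP.toℕ<n p) (m≤m+n σ _))) ∷
    All.map below (zeroRun-above (σ′ ∸ toℕ p))
    where
    p<σ∸[σ′∸p] : toℕ p < σ ∸ (σ′ ∸ toℕ p)
    p<σ∸[σ′∸p] = ≤-reflexive (sym (trans (+-∸-assoc 1 (m∸n≤m σ′ (toℕ p)))
                                         (cong suc (m∸[m∸n]≡n (s≤s⁻¹ (FP.toℕ<n p))))))
    below : ∀ {x : Fin count} → m + (σ ∸ (σ′ ∸ toℕ p)) ≤ toℕ x → toℕ (index (zeroBlocks p)) < toℕ x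
    below {x} = subst (_< toℕ x) (sym (toℕ-index (zeroBlocks p))) ∘ <-≤-trans (+-monoʳ-< m p<σ∸[σ′∸p])

  unitCol-ordered : ∀ N r → OrderedRhs1 N r → OrderedRhs2 (index (unitCol N)) (unitColRhs r)
  unitCol-ordered N (term _)  _           = tt
  unitCol-ordered N (bin A B) (N<A , N<B) =
    index-< (unitCol N) (unitCol A) (+-monoʳ-< m (+-monoʳ-< σ N<A)) ∷
    index-< (unitCol N) (zeroCol B) (+-monoʳ-< m (+-monoʳ-< σ (<-≤-trans N<B (m≤n+m _ m)))) ∷ []

  zeroCol-ordered : ∀ N r → OrderedRhs1 N r → OrderedRhs2 (index (zeroCol N)) (zeroColRhs r)
  zeroCol-ordered N (term _)  _           = tt
  zeroCol-ordered N (bin A B) (N<A , N<B) =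
    index-< (zeroCol N) (zeroCol A) (+-monoʳ-< m (+-monoʳ-< σ (+-monoʳ-< m N<A))) ∷
    index-< (zeroCol N) (zeroCol B) (+-monoʳ-< m (+-monoʳ-< σ (+-monoʳ-< m N<B))) ∷ []

  rhs-ordered : ∀ y → OrderedRhs2 (index y) (rhs y)
  rhs-ordered (marks N)      = marks-ordered N (rule₁ N) (ordered₁ N)
  rhs-ordered (zeroBlocks p) = zeroBlocks-ordered p
  rhs-ordered (unitCol N)    = unitCol-ordered N (rule₁ N) (ordered₁ N)
  rhs-ordered (zeroCol N)    = zeroCol-ordered N (rule₁ N) (ordered₁ N)

  ordered : ∀ x → OrderedRhs2 x (rule x)
  ordered x = subst (λ i → OrderedRhs2 i (rule x)) (strictlyInverseʳ x) (rhs-ordered (to x))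

  G′ : SLG
  G′ = record
    { m       = count
    ; rule    = rule
    ; ordered = ordered
    ; leafNE  = index (zeroCol N₀) , zeroCol-N₀-leaf
    ; start   = index (marks S)
    }
    where
    N₀   = proj₁ terminal
    N₀→a = proj₂ (proj₂ terminal)
    zeroCol-N₀-leaf : IsLeaf (rule (index (zeroCol N₀)))
    zeroCol-N₀-leaf = subst IsLeaf (sym (trans (rule-index (zeroCol N₀)) (cong zeroColRhs N₀→a))) tt

  zeroRun-length : ∀ h → length (zeroRun h) ≤ 1
  zeroRun-length zero    = z≤n
  zeroRun-length (suc h) = s≤s z≤n

  marksRhs-size : ∀ r → rhsSize2 (marksRhs r) ≤ 3
  marksRhs-size (term b)  =
    ⊔-lub (≤-trans (≤-reflexive (LP.length-++ (zeroRun b)))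
                   (+-mono-≤ (zeroRun-length b) (s≤s (zeroRun-length (σ′ ∸ b)))))
          (s≤s z≤n)
  marksRhs-size (bin _ _) = s≤s (s≤s z≤n)

  rhs-size : ∀ y → rhsSize2 (rhs y) ≤ 3
  rhs-size (marks N)      = marksRhs-size (rule₁ N)
  rhs-size (zeroBlocks p) = ⊔-lub (m≤n⇒m≤1+n (s≤s (zeroRun-length (σ′ ∸ toℕ p)))) (s≤s z≤n)
  rhs-size (unitCol N) with rule₁ N
  ... | term _  = s≤s z≤n
  ... | bin _ _ = s≤s (s≤s z≤n)
  rhs-size (zeroCol N) with rule₁ N
  ... | term _  = s≤s z≤n
  ... | bin _ _ = s≤s (s≤s z≤n)

  size-G′ : size2 G′ ≤ 9 * (size1 G + σ)
  size-G′ = begin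
    size2 G′                               ≤⟨ sum-tabulate-mono (rhs-size ∘ to) ⟩
    sum (L.tabulate {n = count} (const 3)) ≡⟨ sum-tabulate-const count 3 ⟩
    count * 3                              ≡⟨ count*3 m σ ⟩
    9 * m + 3 * σ                          ≤⟨ +-mono-≤ (*-monoʳ-≤ 9 (count≤size1 G)) (*-monoˡ-≤ σ 3≤9) ⟩
    9 * size1 G + 9 * σ                    ≡⟨ sym (*-distribˡ-+ 9 (size1 G) σ) ⟩
    9 * (size1 G + σ)                      ∎
    where
    open ≤-Reasoning
    count*3 : ∀ m σ → (m + (σ + (m + m))) * 3 ≡ 9 * m + 3 * σ
    count*3 = solve-∀
    3≤9 : 3 ≤ 9
    3≤9 = s≤s (s≤s (s≤s z≤n))

  open Derivations G′

  zeroCol-yields : ∀ {N w} → Exp1 G N w → Yields (index (zeroCol N)) 1 (zeros (length w))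
  zeroCol-yields {N} (leaf N→a) = yields-leaf (trans (rule-index (zeroCol N)) (cong zeroColRhs N→a))
  zeroCol-yields {N} (node {u = u} {v} N→AB dA dB) =
    subst (Yields _ 1) (trans (zeros-+ (length u) (length v)) (cong zeros (sym (LP.length-++ u))))
          (yields-hor (trans (rule-index (zeroCol N)) (cong zeroColRhs N→AB)) (λ ())
                      (zeroCol-yields dA ∷ [ zeroCol-yields dB ]ˢ))

  unitCol-yields : ∀ {N w} → Exp1 G N w → Yields (index (unitCol N)) 1 ([ 1 ] ∷ zeros (length w ∸ 1))
  unitCol-yields {N} (leaf N→a) = yields-leaf (trans (rule-index (unitCol N)) (cong unitColRhs N→a))
  unitCol-yields {N} (node {u = u} {v} N→AB dA dB) =
    subst (λ L → Yields _ 1 ([ 1 ] ∷ L))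
          (trans (zeros-+ (length u ∸ 1) (length v)) (cong zeros (sym height)))
          (yields-hor (trans (rule-index (unitCol N)) (cong unitColRhs N→AB)) (λ ())
                      (unitCol-yields dA ∷ [ zeroCol-yields dB ]ˢ))
    where
    height : length (u ++ v) ∸ 1 ≡ length u ∸ 1 + length v
    height = trans (cong (_∸ 1) (LP.length-++ u)) (+-∸-comm (length v) (1≤length-exp dA))

  markColumn≢[] : ∀ b → markColumn b ≢ []
  markColumn≢[] b eq with LP.++-conicalʳ (zeroRun b) _ eq
  ... | ()

  module Semantics (k : ℕ) (T : Vec (Fin σ) (suc k)) (D : Exp1 G S (toString T)) where
    open Markers k

    zeroCol-S : Yields (index (zeroCol S)) 1 (zeros (suc k))
    zeroCol-S = subst (λ h → Yields _ 1 (zeros h)) (length-toString T) (zeroCol-yields D)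

    unitCol-S : Yields (index (unitCol S)) 1 ([ 1 ] ∷ zeros k)
    unitCol-S = subst (λ h → Yields _ 1 ([ 1 ] ∷ zeros (h ∸ 1))) (length-toString T) (unitCol-yields D)

    zeroRun-stacked : ∀ h → h ≤ σ → Stacked 1 (zeroRun h) (zeros (h * suc k))
    zeroRun-stacked zero    _          = []
    zeroRun-stacked (suc h) (s≤s h≤σ′) =
      [ yields-hor (rule-index (zeroBlocks p)) (λ ())
          (subst₂ (Stacked 1) (cong (λ j → index (zeroCol S) ∷ zeroRun j) (sym σ′∸p≡h))
                              (zeros-+ (suc k) (h * suc k))
                              (zeroCol-S ∷ zeroRun-stacked h (m≤n⇒m≤1+n h≤σ′))) ]ˢ
      where
      p = fromℕ< (s≤s (m∸n≤m σ′ h))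
      σ′∸p≡h : σ′ ∸ toℕ p ≡ h
      σ′∸p≡h = trans (cong (σ′ ∸_) (FP.toℕ-fromℕ< (s≤s (m∸n≤m σ′ h)))) (m∸[m∸n]≡n h≤σ′)

    markColumn-stacked : ∀ {b} → b < σ → Stacked 1 (markColumn b) (pointwise (markers σ) [ b ])
    markColumn-stacked {b} (s≤s b≤σ′) =
      subst (Stacked 1 (markColumn b)) (sym column)
            (zeroRun-stacked b (m≤n⇒m≤1+n b≤σ′) ++ˢ
             (unitCol-S ∷ zeroRun-stacked (σ′ ∸ b) (m≤n⇒m≤1+n (m∸n≤m σ′ b))))
      where
      b+[σ∸b]≡σ : b + suc (σ′ ∸ b) ≡ σ
      b+[σ∸b]≡σ = trans (+-suc b _) (cong suc (m+[n∸m]≡n b≤σ′))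
      column : pointwise (markers σ) [ b ] ≡
               zeros (b * suc k) ++ ([ 1 ] ∷ zeros k) ++ zeros ((σ′ ∸ b) * suc k)
      column = trans (cong (λ s → pointwise (markers s) [ b ]) (sym b+[σ∸b]≡σ))
                     (markers-column b (σ′ ∸ b))

    marks-yields : ∀ {N w} → Exp1 G N w → All (_< σ) w →
                   Yields (index (marks N)) (length w) (pointwise (markers σ) w)
    marks-yields {N} (leaf {a = b} N→b) (b<σ ∷ []) =
      yields-hor (trans (rule-index (marks N)) (cong marksRhs N→b)) (markColumn≢[] b)
                 (markColumn-stacked b<σ)
    marks-yields {N} (node {u = u} {v} N→AB dA dB) u++v<σ =
      subst₂ (Yields _) (sym (LP.length-++ u)) (zipWith-++-pointwise (markers σ) u v)
             (yields-ver (trans (rule-index (marks N)) (cong marksRhs N→AB))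
                         (marks-yields dA (AllP.++⁻ˡ u u++v<σ)) (marks-yields dB (AllP.++⁻ʳ u u++v<σ))
                         (trans (LP.length-map _ (markers σ)) (sym (LP.length-map _ (markers σ)))))

    represents : Represents2 G′ (ExtMarkAllChars T)
    represents = yields⇒exp2 (subst₂ (Yields _) (length-toString T) (sym (rows-ExtMarkAllChars T))
                                     (marks-yields D (toString-< T)))

lemma8p21 : Σ[ c ∈ ℕ ] ((σ : ℕ) → 0 < σ → (n : ℕ) → 2 ≤ n → (T : Vec (Fin σ) n) →
              (G : SLP) → Represents1 G (toString T) →
              Σ[ G′ ∈ SLG ] (Represents2 G′ (ExtMarkAllChars T) × size2 G′ ≤ c * (size1 G + σ)))
lemma8p21 = 9 , construction
  where
  -- The construction only needs n ≥ 1.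
  construction : (σ : ℕ) → 0 < σ → (n : ℕ) → 2 ≤ n → (T : Vec (Fin σ) n) →
                 (G : SLP) → Represents1 G (toString T) →
                 Σ[ G′ ∈ SLG ] (Represents2 G′ (ExtMarkAllChars T) × size2 G′ ≤ 9 * (size1 G + σ))
  construction (suc σ′) _ (suc k) _ T G D = G′ , represents , size-G′
    where
    open MarkGrammar σ′ G (terminal-rule D)
    open Semantics k T D
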